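{- Let $(\mathbb{O},\leq)$ and $(\mathbb{P},\sqsubseteq)$ be complete lattices and let $F:\mathbb{O}\to\mathbb{P}$ and $G:\mathbb{P}\to\mathbb{O}$ be continuous mutual endofunctions (in the sense defined in the context). For $O\in\mathbb{O}$ and $P\in\mathbb{P}$ define $PreFP_{F,G}(O)=\{P'\in\mathbb{P}\mid F(O)\sqsubseteq P'\text{ and }G(P')\leq O\}$, $PreFP_{G,F}(P)=\{O'\in\mathbb{O}\mid F(O')\sqsubseteq P\text{ and }G(P)\leq O'\}$, $PostFP_{F,G}(O)=\{P'\in\mathbb{P}\mid P'\sqsubseteq F(O)\text{ and }O\leq G(P')\}$, $PostFP_{G,F}(P)=\{O'\in\mathbb{O}\mid P\sqsubseteq F(O')\text{ and }O'\leq G(P)\}$. Then for all $O\in\mathbb{O}$ and $P\in\mathbb{P}$, each of the sets $PreFP_{F,G}(O)$, $PreFP_{G,F}(P)$, $PostFP_{F,G}(O)$, $PostFP_{G,F}(P)$ is either empty or a complete lattice (under the order inherited from $\mathbb{P}$ or $\mathbb{O}$).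
   Context: For posets $(\mathbb{O},\leq)$ (meets $\wedge$, joins $\vee$) and $(\mathbb{P},\sqsubseteq)$ (meets $\sqcap$, joins $\sqcup$), maps $F:\mathbb{O}\to\mathbb{P}$, $G:\mathbb{P}\to\mathbb{O}$ are continuous mutual endofunctions if for every subset $\mathbb{M}\subseteq\mathbb{O}$ whose meet (resp. join) exists, the meet (resp. join) of $F(\mathbb{M})$ exists and $\sqcap F(\mathbb{M})=F(\wedge\mathbb{M})$ (resp. $\sqcup F(\mathbb{M})=F(\vee\mathbb{M})$), and symmetrically for every $\mathbb{N}\subseteq\mathbb{P}$ whose meet (resp. join) exists, the meet (resp. join) of $G(\mathbb{N})$ exists and $\wedge G(\mathbb{N})=G(\sqcap\mathbb{N})$ (resp. $\vee G(\mathbb{N})=G(\sqcup\mathbb{N})$). -}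

module Defs where

open import Level using (Level; _⊔_; suc)
open import Data.Product using (Σ; ∃; _×_; _,_)
open import Relation.Unary using (Pred; _⊆_)
open import Relation.Binary.Bundles using (Poset)
open import Relation.Binary.PropositionalEquality using (_≡_)

module _ {c ℓ₁ ℓ₂ : Level} (𝕆 : Poset c ℓ₁ ℓ₂) where
  open Poset 𝕆

  IsLowerBound : ∀ {s} → Pred Carrier s → Carrier → Set (c ⊔ s ⊔ ℓ₂)
  IsLowerBound M x = ∀ y → M y → x ≤ y

  IsUpperBound : ∀ {s} → Pred Carrier s → Carrier → Set (c ⊔ s ⊔ ℓ₂)
  IsUpperBound M x = ∀ y → M y → y ≤ x

  IsMeet : ∀ {s} → Pred Carrier s → Carrier → Set (c ⊔ s ⊔ ℓ₂)
  IsMeet M x = IsLowerBound M x × (∀ z → IsLowerBound M z → z ≤ x)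

  IsJoin : ∀ {s} → Pred Carrier s → Carrier → Set (c ⊔ s ⊔ ℓ₂)
  IsJoin M x = IsUpperBound M x × (∀ z → IsUpperBound M z → x ≤ z)

  IsMeetIn : ∀ {s t} → Pred Carrier s → Pred Carrier t → Carrier → Set (c ⊔ s ⊔ t ⊔ ℓ₂)
  IsMeetIn S T x = S x × IsLowerBound T x × (∀ z → S z → IsLowerBound T z → z ≤ x)

  IsJoinIn : ∀ {s t} → Pred Carrier s → Pred Carrier t → Carrier → Set (c ⊔ s ⊔ t ⊔ ℓ₂)
  IsJoinIn S T x = S x × IsUpperBound T x × (∀ z → S z → IsUpperBound T z → x ≤ z)

  IsCompleteSubLattice : ∀ {s} (t : Level) → Pred Carrier s → Set (c ⊔ s ⊔ ℓ₂ ⊔ suc t)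
  IsCompleteSubLattice t S =
    (T : Pred Carrier t) → T ⊆ S → (∃ λ x → IsMeetIn S T x) × (∃ λ x → IsJoinIn S T x)

record CompleteLattice (ℓ : Level) : Set (suc ℓ) where
  field
    poset : Poset ℓ ℓ ℓ
  open Poset poset public
  field
    ⋀ : Pred Carrier ℓ → Carrier
    ⋁ : Pred Carrier ℓ → Carrier
    ⋀-isMeet : ∀ M → IsMeet poset M (⋀ M)
    ⋁-isJoin : ∀ M → IsJoin poset M (⋁ M)

Image : ∀ {ℓ} {A B : Set ℓ} → (A → B) → Pred A ℓ → Pred B ℓ
Image F M p = ∃ λ o → M o × F o ≡ p

module _ {ℓ : Level} (𝕆 ℙ : CompleteLattice ℓ) where
  private
    module O = CompleteLattice 𝕆
    module P = CompleteLattice ℙ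

  -- Since both posets are complete, every
  -- subset has a meet and a join, so the condition says that F and G send
  -- meets to meets and joins to joins of the image sets.
  record ContinuousMutualEndofunctions (F : O.Carrier → P.Carrier) (G : P.Carrier → O.Carrier)
         : Set (suc ℓ) where
    field
      F-meet : (M : Pred O.Carrier ℓ) → IsMeet P.poset (Image F M) (F (O.⋀ M))
      F-join : (M : Pred O.Carrier ℓ) → IsJoin P.poset (Image F M) (F (O.⋁ M))
      G-meet : (N : Pred P.Carrier ℓ) → IsMeet O.poset (Image G N) (G (P.⋀ N))
      G-join : (N : Pred P.Carrier ℓ) → IsJoin O.poset (Image G N) (G (P.⋁ N))

  PreFP-FG : (F : O.Carrier → P.Carrier) (G : P.Carrier → O.Carrier) → O.Carrier → Pred P.Carrier ℓ
  PreFP-FG F G O P′ = F O P.≤ P′ × G P′ O.≤ O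

  PreFP-GF : (F : O.Carrier → P.Carrier) (G : P.Carrier → O.Carrier) → P.Carrier → Pred O.Carrier ℓ
  PreFP-GF F G P O′ = F O′ P.≤ P × G P O.≤ O′

  PostFP-FG : (F : O.Carrier → P.Carrier) (G : P.Carrier → O.Carrier) → O.Carrier → Pred P.Carrier ℓ
  PostFP-FG F G O P′ = P′ P.≤ F O × O O.≤ G P′

  PostFP-GF : (F : O.Carrier → P.Carrier) (G : P.Carrier → O.Carrier) → P.Carrier → Pred O.Carrier ℓ
  PostFP-GF F G P O′ = P P.≤ F O′ × O′ O.≤ G P

-- "S is empty or S is a complete lattice", stated constructively as
-- "if S is nonempty then S is a complete lattice" (classically equivalent).
EmptyOrCompleteLattice : ∀ {ℓ} (L : Poset ℓ ℓ ℓ) → Pred (Poset.Carrier L) ℓ → Set (suc ℓ)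
EmptyOrCompleteLattice {ℓ} L S = (∃ λ x → S x) → IsCompleteSubLattice L ℓ S

-- A subset S of a complete lattice that is closed under meets and joins of its
-- inhabited subsets is itself a complete lattice as soon as it has an element s:
-- for T ⊆ S, the join of the lower bounds of T lying in S is the meet of T in S,
-- and this set of lower bounds is inhabited by ⋀ (T ∪ {s}).  Each of the four
-- sets is the intersection of a principal up- or down-set with the preimage of
-- one under F or G, and continuity makes all such sets closed in this sense.
module Submission where

open import Defs
open import Level using (Level; suc)
open import Function using (_∘_)
open import Data.Product using (_×_; _,_; proj₁; proj₂)
open import Data.Sum using (_⊎_; inj₁; inj₂)
open import Relation.Unary using (Pred; _⊆_; _∩_; Satisfiable)
open import Relation.Binary.PropositionalEquality using (_≡_; refl)

module _ {ℓ : Level} (L : CompleteLattice ℓ) where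
  open CompleteLattice L hiding (refl)

  ⋀⋁-Closed : Pred Carrier ℓ → Set (suc ℓ)
  ⋀⋁-Closed S = (N : Pred Carrier ℓ) → N ⊆ S → Satisfiable N → S (⋀ N) × S (⋁ N)

  ⋀⋁-closed⇒emptyOrCompleteLattice : ∀ {S} → ⋀⋁-Closed S → EmptyOrCompleteLattice poset S
  ⋀⋁-closed⇒emptyOrCompleteLattice {S} closed (s , s∈S) T T⊆S = meetIn , joinIn
    where
    T∪s : Pred Carrier ℓ
    T∪s y = T y ⊎ s ≡ y

    T∪s⊆S : T∪s ⊆ S
    T∪s⊆S (inj₁ y∈T) = T⊆S y∈T
    T∪s⊆S (inj₂ refl) = s∈S

    T∪s-bounds-in-S : S (⋀ T∪s) × S (⋁ T∪s)
    T∪s-bounds-in-S = closed T∪s T∪s⊆S (s , inj₂ refl)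

    lowerBoundsIn-S upperBoundsIn-S : Pred Carrier ℓ
    lowerBoundsIn-S y = S y × IsLowerBound poset T y
    upperBoundsIn-S y = S y × IsUpperBound poset T y

    meetIn : ∃⟨ IsMeetIn poset S T ⟩
    meetIn = ⋁ lowerBoundsIn-S
      , proj₂ (closed lowerBoundsIn-S proj₁
                (⋀ T∪s , proj₁ T∪s-bounds-in-S , λ t t∈T → proj₁ (⋀-isMeet T∪s) t (inj₁ t∈T)))
      , (λ t t∈T → proj₂ (⋁-isJoin lowerBoundsIn-S) t (λ _ y∈lbs → proj₂ y∈lbs t t∈T))
      , λ z z∈S z-lb → proj₁ (⋁-isJoin lowerBoundsIn-S) z (z∈S , z-lb)

    joinIn : ∃⟨ IsJoinIn poset S T ⟩
    joinIn = ⋀ upperBoundsIn-S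
      , proj₁ (closed upperBoundsIn-S proj₁
                (⋁ T∪s , proj₂ T∪s-bounds-in-S , λ t t∈T → proj₁ (⋁-isJoin T∪s) t (inj₁ t∈T)))
      , (λ t t∈T → proj₂ (⋀-isMeet upperBoundsIn-S) t (λ _ y∈ubs → proj₂ y∈ubs t t∈T))
      , λ z z∈S z-ub → proj₁ (⋀-isMeet upperBoundsIn-S) z (z∈S , z-ub)

  ∩-⋀⋁-closed : ∀ {S S′} → ⋀⋁-Closed S → ⋀⋁-Closed S′ → ⋀⋁-Closed (S ∩ S′)
  ∩-⋀⋁-closed closed closed′ N N⊆S∩S′ inhabited
    with closed N (proj₁ ∘ N⊆S∩S′) inhabited | closed′ N (proj₂ ∘ N⊆S∩S′) inhabited
  ... | ⋀∈S , ⋁∈S | ⋀∈S′ , ⋁∈S′ = (⋀∈S , ⋀∈S′) , (⋁∈S , ⋁∈S′)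

  ↑-⋀⋁-closed : ∀ a → ⋀⋁-Closed (a ≤_)
  ↑-⋀⋁-closed a N N⊆↑a (n , n∈N) =
    proj₂ (⋀-isMeet N) a (λ _ → N⊆↑a) , trans (N⊆↑a n∈N) (proj₁ (⋁-isJoin N) n n∈N)

  ↓-⋀⋁-closed : ∀ a → ⋀⋁-Closed (_≤ a)
  ↓-⋀⋁-closed a N N⊆↓a (n , n∈N) =
    trans (proj₁ (⋀-isMeet N) n n∈N) (N⊆↓a n∈N) , proj₂ (⋁-isJoin N) a (λ _ → N⊆↓a)

module _ {ℓ : Level} (L M : CompleteLattice ℓ) where
  private
    module L = CompleteLattice L
    module M = CompleteLattice M

  PreservesMeets PreservesJoins : (L.Carrier → M.Carrier) → Set (suc ℓ)
  PreservesMeets H = (N : Pred L.Carrier ℓ) → IsMeet M.poset (Image H N) (H (L.⋀ N))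
  PreservesJoins H = (N : Pred L.Carrier ℓ) → IsJoin M.poset (Image H N) (H (L.⋁ N))

  module _ {H : L.Carrier → M.Carrier} (H-meet : PreservesMeets H) (H-join : PreservesJoins H) where

    preimage-↑-⋀⋁-closed : ∀ b → ⋀⋁-Closed L ((b M.≤_) ∘ H)
    preimage-↑-⋀⋁-closed b N N⊆H⁻¹↑b (n , n∈N) =
      proj₂ (H-meet N) b (λ { _ (_ , n′∈N , refl) → N⊆H⁻¹↑b n′∈N })
      , M.trans (N⊆H⁻¹↑b n∈N) (proj₁ (H-join N) (H n) (n , n∈N , refl))

    preimage-↓-⋀⋁-closed : ∀ b → ⋀⋁-Closed L ((M._≤ b) ∘ H)
    preimage-↓-⋀⋁-closed b N N⊆H⁻¹↓b (n , n∈N) =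
      M.trans (proj₁ (H-meet N) (H n) (n , n∈N , refl)) (N⊆H⁻¹↓b n∈N)
      , proj₂ (H-join N) b (λ { _ (_ , n′∈N , refl) → N⊆H⁻¹↓b n′∈N })

lemma5 : {ℓ : Level} (𝕆 ℙ : CompleteLattice ℓ)
    (F : CompleteLattice.Carrier 𝕆 → CompleteLattice.Carrier ℙ)
    (G : CompleteLattice.Carrier ℙ → CompleteLattice.Carrier 𝕆) →
    ContinuousMutualEndofunctions 𝕆 ℙ F G →
    (O : CompleteLattice.Carrier 𝕆) (P : CompleteLattice.Carrier ℙ) →
    EmptyOrCompleteLattice (CompleteLattice.poset ℙ) (PreFP-FG 𝕆 ℙ F G O)
    × EmptyOrCompleteLattice (CompleteLattice.poset 𝕆) (PreFP-GF 𝕆 ℙ F G P)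
    × EmptyOrCompleteLattice (CompleteLattice.poset ℙ) (PostFP-FG 𝕆 ℙ F G O)
    × EmptyOrCompleteLattice (CompleteLattice.poset 𝕆) (PostFP-GF 𝕆 ℙ F G P)
lemma5 𝕆 ℙ F G continuous O P =
    ⋀⋁-closed⇒emptyOrCompleteLattice ℙ
      (∩-⋀⋁-closed ℙ (↑-⋀⋁-closed ℙ (F O)) (preimage-↓-⋀⋁-closed ℙ 𝕆 G-meet G-join O))
  , ⋀⋁-closed⇒emptyOrCompleteLattice 𝕆
      (∩-⋀⋁-closed 𝕆 (preimage-↓-⋀⋁-closed 𝕆 ℙ F-meet F-join P) (↑-⋀⋁-closed 𝕆 (G P)))
  , ⋀⋁-closed⇒emptyOrCompleteLattice ℙ
      (∩-⋀⋁-closed ℙ (↓-⋀⋁-closed ℙ (F O)) (preimage-↑-⋀⋁-closed ℙ 𝕆 G-meet G-join O))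
  , ⋀⋁-closed⇒emptyOrCompleteLattice 𝕆
      (∩-⋀⋁-closed 𝕆 (preimage-↑-⋀⋁-closed 𝕆 ℙ F-meet F-join P) (↓-⋀⋁-closed 𝕆 (G P)))
  where open ContinuousMutualEndofunctions continuous
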